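{- Let $b$ be a positive integer. Let $\mathcal M_1=\{4,4\}_{b,0}$ be the regular map on the torus $\mathbb C/b\mathbb Z[i]$ and $\mathcal M_2=\{4,4\}_{b,b}$ the regular map on the torus $\mathbb C/(b+bi)\mathbb Z[i]$, both induced by the tessellation of $\mathbb C$ by unit squares with vertices at the Gaussian integers $\mathbb Z[i]$. Then the pattern of a mirror of a reflection of $\mathcal M_1$ is $(\mathbf{01})^b$, $(\mathbf{02})^b$ or $(\mathbf{12})^b$, and the pattern of a mirror of a reflection of $\mathcal M_2$ is $(\mathbf{01})^{2b}$, $(\mathbf{02})^b$ or $(\mathbf{12})^{2b}$.
   Context: The geometric points of a map are its vertices (denoted $\mathbf 0$), edge-centres (denoted $\mathbf 1$) and face-centres (denoted $\mathbf 2$). A reflection of the map is an orientation-reversing involutive automorphism; its fixed curves (mirrors) pass through geometric points, and the pattern of a mirror is the cyclic sequence of geometric points met along it, written $(\ell)^K$ to mean the word $\ell$ repeated $K$ times around the closed mirror (here $\ell$ is the minimal repeating block, and $K$ is the link index). -}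

module Defs where

open import Data.Nat as ℕ using (ℕ; zero; suc; _<_; _≤_)
open import Data.Integer as ℤ using (ℤ; +_; -_; ∣_∣)
open import Data.Product using (_×_; _,_; ∃; ∃₂)
open import Data.Bool using (Bool; true; false; if_then_else_)
open import Relation.Binary.PropositionalEquality using (_≡_; _≢_)
open import Relation.Nullary using (¬_)

-- Geometric points of the square tessellation of ℂ are the points of ½ℤ[i].
-- We use DOUBLED coordinates: the point (x + i y)/2 is represented by (x , y) ∈ ℤ².
-- Vertices: x, y both even; edge-centres: exactly one odd; face-centres: both odd.
Pt : Set
Pt = ℤ × ℤ

_⊕_ : Pt → Pt → Pt
(a , b) ⊕ (c , d) = (a ℤ.+ c , b ℤ.+ d)

_⊖_ : Pt → Pt → Pt
(a , b) ⊖ (c , d) = (a ℤ.- c , b ℤ.- d)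

-- type of a geometric point: 0 = vertex, 1 = edge-centre, 2 = face-centre
type : Pt → ℕ
type (x , y) = (∣ x ∣ ℕ.% 2) ℕ.+ (∣ y ∣ ℕ.% 2)

rot : Pt → Pt
rot (x , y) = (- y , x)

conj : Pt → Pt
conj (x , y) = (x , - y)

rot^ : ℕ → Pt → Pt
rot^ zero v = v
rot^ (suc k) v = rot (rot^ k v)

-- The torus ℂ / ωℤ[i], ω = p + i q: lattice spanned by ω and iω,
-- written in doubled coordinates.
InLattice : Pt → Pt → Set
InLattice (p , q) v = ∃₂ λ m n →
  v ≡ ( ℤ.+ 2 ℤ.* (m ℤ.* p ℤ.- n ℤ.* q) , ℤ.+ 2 ℤ.* (m ℤ.* q ℤ.+ n ℤ.* p) )

_≡[_]_ : Pt → Pt → Pt → Set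
u ≡[ ω ] v = InLattice ω (u ⊖ v)

-- A symmetry of the square tessellation of ℂ: z ↦ iᵏ z + t or z ↦ iᵏ z̄ + t,
-- with t = tx + i ty ∈ ℤ[i].
record Sym : Set where
  field
    k   : ℕ
    rev : Bool
    tx  : ℤ
    ty  : ℤ

lin : Sym → Pt → Pt
lin f v = rot^ (Sym.k f) (if Sym.rev f then conj v else v)

apply : Sym → Pt → Pt
apply f v = lin f v ⊕ (ℤ.+ 2 ℤ.* Sym.tx f , ℤ.+ 2 ℤ.* Sym.ty f)

IsAut : Pt → Sym → Set
IsAut ω f = ∀ u v → u ≡[ ω ] v → apply f u ≡[ ω ] apply f v

IsReflection : Pt → Sym → Set
IsReflection ω f = IsAut ω f × Sym.rev f ≡ true × (∀ v → apply f (apply f v) ≡[ ω ] v)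

Fixed : Pt → Sym → Pt → Set
Fixed ω f v = apply f v ≡[ ω ] v

-- a unit step in the barycentric subdivision (Chebyshev distance 1)
IsStep : Pt → Set
IsStep (dx , dy) = ∣ dx ∣ ≤ 1 × ∣ dy ∣ ≤ 1 × ¬ ((dx , dy) ≡ (ℤ.+ 0 , ℤ.+ 0))

-- the edge of the barycentric subdivision (flag complex) from v to v ⊕ δ
-- is pointwise fixed by f
FixedEdge : Pt → Sym → Pt → Pt → Set
FixedEdge ω f v δ = IsStep δ × type v ≢ type (v ⊕ δ) × Fixed ω f v × lin f δ ≡ δ

-- p 0, p 1, … , p n (≡ p 0) traverses a whole mirror (a connected component
-- of the fixed set of f, which is a union of fixed edges of the barycentric
-- subdivision) exactly once, listing the geometric points met along it.
Mirror : Pt → Sym → ℕ → (ℕ → Pt) → Set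
Mirror ω f n p =
    1 ≤ n
  × (∀ i → p (i ℕ.+ n) ≡[ ω ] p i)
  × (∀ i → FixedEdge ω f (p i) (p (suc i) ⊖ p i))
  × (∀ i j → i < n → j < n → p i ≡[ ω ] p j → i ≡ j)
  × (∀ i δ → FixedEdge ω f (p i) δ → ∃ λ j → (p i ⊕ δ) ≡[ ω ] p j)

alt : ℕ → ℕ → ℕ → ℕ
alt x y zero = x
alt x y (suc i) = alt y x i

-- the pattern of the mirror (p, n) is (x y)^K  (x ≠ y, so xy is the minimal block)
HasPattern : ℕ → (ℕ → Pt) → ℕ → ℕ → ℕ → Set
HasPattern n p x y K = n ≡ 2 ℕ.* K × ∃ λ r → ∀ i → type (p (r ℕ.+ i)) ≡ alt x y i

ω₁ : ℕ → Pt
ω₁ b = (ℤ.+ b , ℤ.+ 0)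

ω₂ : ℕ → Pt
ω₂ b = (ℤ.+ b , ℤ.+ b)

-- A reflection of a quotient of the square tessellation is z ↦ iᵏ z̄ + t.  Its
-- fixed unit steps all point along ONE direction d (horizontal, ascending
-- diagonal, vertical or descending diagonal, according to k mod 4), so every
-- mirror is a straight line  p i = p 0 + c i · d,  where c is a ±1 walk on ℤ.
-- Two points of this line coincide on the torus iff their positions are
-- congruent modulo the period N of d in the lattice.  A purely arithmetical
-- lemma about closed ±1 walks on ℤ/N (cycle-length) then shows that the mirror
-- meets exactly N geometric points.  Independently, the parities of the two
-- coordinates of a point flip in a fixed way at each step along d, so the
-- types of the points met alternate: 0,1 or 1,2 for axial directions and 0,2
-- for diagonal ones.  Finally the periods are computed from explicit
-- descriptions of the two lattices: 2b for every direction of {4,4}_{b,0};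
-- 4b for axial and 2b for diagonal directions of {4,4}_{b,b}.
module Submission where

open import Defs
open import Data.Nat as ℕ using (ℕ; zero; suc; _≤_; _<_; z≤n; s≤s)
import Data.Nat.Properties as ℕP
import Data.Nat.Divisibility as ℕ∣
open import Data.Nat.DivMod using (_%_; [m+n]%n≡m%n)
open import Data.Integer using (ℤ; +_; -[1+_]; _+_; _*_; _-_; -_; ∣_∣)
import Data.Integer.Properties as ℤP
open import Data.Integer.Divisibility.Signed
  using (_∣_; divides; ∣⇒∣ᵤ; ∣-refl; ∣-trans; ∣m∣n⇒∣m+n; ∣m⇒∣-m; ∣m⇒∣m*n)
open import Data.Integer.Tactic.RingSolver using (solve-∀)
open import Data.Bool using (Bool; true; false; not)
open import Data.Bool.Properties using (not-involutive)
open import Data.Product using (_×_; _,_; ∃; proj₁; proj₂; map₂)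
open import Data.Sum using (_⊎_; inj₁; inj₂)
open import Data.Empty using (⊥; ⊥-elim)
open import Function.Bundles using (_⇔_; mk⇔; Equivalence)
import Function.Properties.Equivalence as ⇔
open import Relation.Binary.PropositionalEquality

open Equivalence using (to; from)

data IsSign : ℤ → Set where
  plus  : IsSign (+ 1)
  minus : IsSign -[1+ 0 ]

negate : ∀ {s} → IsSign s → IsSign (- s)
negate plus  = minus
negate minus = plus

∣sign∣ : ∀ {s} → IsSign s → ∣ s ∣ ≡ 1
∣sign∣ plus  = refl
∣sign∣ minus = refl

∣multiple-of-sign∣ : ∀ i {s} → IsSign s → ∣ + i * s ∣ ≡ i
∣multiple-of-sign∣ i {s} σ = begin
  ∣ + i * s ∣    ≡⟨ ℤP.abs-* (+ i) s ⟩
  i ℕ.* ∣ s ∣    ≡⟨ cong (i ℕ.*_) (∣sign∣ σ) ⟩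
  i ℕ.* 1        ≡⟨ ℕP.*-identityʳ i ⟩
  i              ∎
  where open ≡-Reasoning

repeat-or-reverse : ∀ x {s t} → IsSign s → IsSign t → t ≡ s ⊎ (x + s) + t ≡ x
repeat-or-reverse x plus  plus  = inj₁ refl
repeat-or-reverse x minus minus = inj₁ refl
repeat-or-reverse x plus  minus = inj₂ (cancel x)
  where cancel : ∀ x → (x + + 1) + -[1+ 0 ] ≡ x
        cancel = solve-∀
repeat-or-reverse x minus plus  = inj₂ (cancel x)
  where cancel : ∀ x → (x + -[1+ 0 ]) + + 1 ≡ x
        cancel = solve-∀

-- Closed ±1 walks on ℤ / N

position : (ℕ → ℤ) → ℕ → ℤ
position e zero    = + 0
position e (suc i) = position e i + e i

module Walk (N : ℕ) (2≤N : 2 ≤ N) where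

  infix 4 _≋_

  record _≋_ (x y : ℤ) : Set where
    constructor congruent
    field difference : + N ∣ x - y
  open _≋_ public

  ≋-reflexive : ∀ {x y} → x ≡ y → x ≋ y
  ≋-reflexive {x} refl = congruent (divides (+ 0) (ℤP.+-inverseʳ x))

  ≋-trans : ∀ {x y z} → x ≋ y → y ≋ z → x ≋ z
  ≋-trans {x} {y} {z} (congruent x≋y) (congruent y≋z) =
    congruent (subst (+ N ∣_) (telescope x y z) (∣m∣n⇒∣m+n x≋y y≋z))
    where telescope : ∀ x y z → (x - y) + (y - z) ≡ x - z
          telescope = solve-∀

  multiple-bound : ∀ {z k} → + N ∣ z → ∣ z ∣ ≡ k → 0 < k → N ≤ k
  multiple-bound N∣z refl 0<∣z∣ = ℕ∣.∣⇒≤ {{ℕ.>-nonZero 0<∣z∣}} (∣⇒∣ᵤ N∣z)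

  sign-not-multiple : ∀ {s} → IsSign s → + N ∣ s → ⊥
  sign-not-multiple σ N∣s = ℕP.<⇒≱ 2≤N (multiple-bound N∣s (∣sign∣ σ) (s≤s z≤n))

  record Cycle (e : ℕ → ℤ) (n : ℕ) : Set where
    field
      unit-steps : ∀ i → IsSign (e i)
      nonempty   : 1 ≤ n
      closes-up  : ∀ i → position e (i ℕ.+ n) ≋ position e i
      simple     : ∀ i j → i < n → j < n → position e i ≋ position e j → i ≡ j
      extendable : ∀ i → ∃ λ j → position e (suc i) + e i ≋ position e j

  -- A cycle of length at least 3 never reverses, so it is the straight walk
  -- 0, ±1, ±2, … and its length is the first positive multiple of N.
  module LongCycle {e n} (C : Cycle e n) (3≤n : 3 ≤ n) where
    open Cycle C
    c = position e

    0<n : 0 < n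
    0<n = ℕP.<-trans (s≤s z≤n) 3≤n

    no-reversal : ∀ i → 2 ℕ.+ i ≤ n → e (suc i) ≡ e i
    no-reversal i 2+i≤n with repeat-or-reverse (c i) (unit-steps i) (unit-steps (suc i))
    ... | inj₁ same = same
    ... | inj₂ back with ℕP.m≤n⇒m<n∨m≡n 2+i≤n
    ...   | inj₁ 2+i<n = ⊥-elim (ℕP.m≢1+n+m i {1}
              (simple i (2 ℕ.+ i) (ℕP.<-trans (ℕP.m<n+m i (s≤s z≤n)) 2+i<n) 2+i<n
                (≋-reflexive (sym back))))
    ...   | inj₂ refl = ⊥-elim (ℕP.<⇒≢ 3≤n (cong (2 ℕ.+_) (sym i≡0)))
      where
      -- the reversal returns to c i = c n ≡ c 0, forcing i = 0 and n = 2
      i≡0 : i ≡ 0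
      i≡0 = simple i 0 (ℕP.m<n+m i (s≤s z≤n)) 0<n
              (≋-trans (≋-reflexive (sym back)) (closes-up 0))

    constant-step : ∀ i → i < n → e i ≡ e 0
    constant-step zero    _     = refl
    constant-step (suc i) i+1<n =
      trans (no-reversal i i+1<n) (constant-step i (ℕP.<-trans (ℕP.n<1+n i) i+1<n))

    straight : ∀ i → i ≤ n → c i ≡ + i * e 0
    straight zero    _     = refl
    straight (suc i) i+1≤n = begin
      c i + e i             ≡⟨ cong₂ _+_ (straight i (ℕP.<⇒≤ i+1≤n)) (constant-step i i+1≤n) ⟩
      + i * e 0 + e 0       ≡⟨ step (+ i) (e 0) ⟩
      (+ 1 + + i) * e 0     ∎
      where open ≡-Reasoning
            step : ∀ j x → j * x + x ≡ (+ 1 + j) * x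
            step = solve-∀

    displacement : ∀ i → i ≤ n → c i - c 0 ≡ + i * e 0
    displacement i i≤n = trans (ℤP.+-identityʳ (c i)) (straight i i≤n)

    length : n ≡ N
    length = ℕP.≤-antisym n≤N N≤n
      where
      N≤n : N ≤ n
      N≤n = multiple-bound (subst (+ N ∣_) (displacement n ℕP.≤-refl) (difference (closes-up 0)))
              (∣multiple-of-sign∣ n (unit-steps 0)) 0<n
      -- if N < n, the N-th point would coincide with the starting point
      back-at-start : N < n → N ≡ 0
      back-at-start N<n = simple N 0 N<n 0<n (congruent
        (subst (+ N ∣_) (sym (displacement N (ℕP.<⇒≤ N<n))) (∣m⇒∣m*n (e 0) ∣-refl)))
      n≤N : n ≤ N
      n≤N = ℕP.≮⇒≥ λ N<n → ℕP.<⇒≢ (ℕP.<-trans (s≤s z≤n) 2≤N) (sym (back-at-start N<n))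

  -- A cycle of length 2 forces N = 2: its straight continuation
  -- from the first point returns to one of its two residues.
  module ShortCycle {e} (C : Cycle e 2) where
    open Cycle C
    c = position e

    residue : ∀ j → c j ≋ c 0 ⊎ c j ≋ c 1
    residue zero          = inj₁ (≋-reflexive refl)
    residue (suc zero)    = inj₂ (≋-reflexive refl)
    residue (suc (suc j)) with residue j
    ... | inj₁ r = inj₁ (≋-trans (subst (λ k → c k ≋ c j) (ℕP.+-comm j 2) (closes-up j)) r)
    ... | inj₂ r = inj₂ (≋-trans (subst (λ k → c k ≋ c j) (ℕP.+-comm j 2) (closes-up j)) r)

    length : 2 ≡ N
    length with extendable 0
    ... | j , ahead with residue j
    ...   | inj₁ r = ℕP.≤-antisym 2≤N
            (multiple-bound (subst (+ N ∣_) (two-steps (e 0)) (difference (≋-trans ahead r)))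
              (double (unit-steps 0)) (s≤s z≤n))
      where
      two-steps : ∀ s → ((+ 0 + s) + s) - + 0 ≡ s + s
      two-steps = solve-∀
      double : ∀ {s} → IsSign s → ∣ s + s ∣ ≡ 2
      double plus  = refl
      double minus = refl
    ...   | inj₂ r = ⊥-elim (sign-not-multiple (unit-steps 0)
            (subst (+ N ∣_) (one-step (e 0)) (difference (≋-trans ahead r))))
      where
      one-step : ∀ s → ((+ 0 + s) + s) - (+ 0 + s) ≡ s
      one-step = solve-∀

  cycle-length : ∀ {e} n → Cycle e n → n ≡ N
  cycle-length zero C = ⊥-elim (ℕP.<-irrefl refl (Cycle.nonempty C))
  cycle-length {e} (suc zero) C = ⊥-elim (sign-not-multiple (Cycle.unit-steps C 0)
    (subst (+ N ∣_) (one-step (e 0)) (difference (Cycle.closes-up C 0))))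
    where
    one-step : ∀ s → (+ 0 + s) - + 0 ≡ s
    one-step = solve-∀
  cycle-length (suc (suc zero)) C = ShortCycle.length C
  cycle-length (suc (suc (suc n))) C = LongCycle.length C (s≤s (s≤s (s≤s z≤n)))

-- Parities and types of geometric points

odd : ℕ → Bool
odd zero    = false
odd (suc n) = not (odd n)

bit : Bool → ℕ
bit false = 0
bit true  = 1

%2≡bit-odd : ∀ n → n % 2 ≡ bit (odd n)
%2≡bit-odd zero          = refl
%2≡bit-odd (suc zero)    = refl
%2≡bit-odd (suc (suc n)) = begin
  (2 ℕ.+ n) % 2            ≡⟨ cong (_% 2) (ℕP.+-comm 2 n) ⟩
  (n ℕ.+ 2) % 2            ≡⟨ [m+n]%n≡m%n n 2 ⟩
  n % 2                    ≡⟨ %2≡bit-odd n ⟩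
  bit (odd n)              ≡⟨ cong bit (sym (not-involutive (odd n))) ⟩
  bit (odd (suc (suc n)))  ∎
  where open ≡-Reasoning

oddℤ : ℤ → Bool
oddℤ z = odd ∣ z ∣

oddℤ-step : ∀ {s} → IsSign s → ∀ z → oddℤ (z + s) ≡ not (oddℤ z)
oddℤ-step plus (+ n) rewrite ℕP.+-comm n 1 = refl
oddℤ-step plus -[1+ zero ]    = refl
oddℤ-step plus -[1+ suc n ]   = sym (not-involutive _)
oddℤ-step minus (+ zero)      = refl
oddℤ-step minus (+ suc n)     = sym (not-involutive _)
oddℤ-step minus -[1+ n ] rewrite ℕP.+-identityʳ n = refl

oddℤ-+0 : ∀ z → oddℤ (z + + 0) ≡ oddℤ z
oddℤ-+0 z = cong oddℤ (ℤP.+-identityʳ z)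

parities : Pt → Bool × Bool
parities (x , y) = (oddℤ x , oddℤ y)

weight : Bool × Bool → ℕ
weight (a , b) = bit a ℕ.+ bit b

type≡weight : ∀ v → type v ≡ weight (parities v)
type≡weight (x , y) = cong₂ ℕ._+_ (%2≡bit-odd ∣ x ∣) (%2≡bit-odd ∣ y ∣)

data Dir : Set where
  horizontal ascending vertical descending : Dir

along : Dir → ℤ → Pt
along horizontal z = (z , + 0)
along ascending  z = (z , z)
along vertical   z = (+ 0 , z)
along descending z = (z , - z)

data Kind : Set where
  axial diagonal : Kind

kind : Dir → Kind
kind horizontal = axial
kind ascending  = diagonal
kind vertical   = axial
kind descending = diagonal

along-zero : ∀ d → along d (+ 0) ≡ (+ 0 , + 0)
along-zero horizontal = refl
along-zero ascending  = refl
along-zero vertical   = refl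
along-zero descending = refl

along-+ : ∀ d a b → along d a ⊕ along d b ≡ along d (a + b)
along-+ horizontal a b = refl
along-+ ascending  a b = refl
along-+ vertical   a b = refl
along-+ descending a b = cong (a + b ,_) (sym (ℤP.neg-distrib-+ a b))

along-- : ∀ d a b → along d a ⊖ along d b ≡ along d (a - b)
along-- horizontal a b = refl
along-- ascending  a b = refl
along-- vertical   a b = refl
along-- descending a b = cong (a - b ,_) (negated-difference a b)
  where negated-difference : ∀ a b → - a - - b ≡ - (a - b)
        negated-difference = solve-∀

record Along (d : Dir) (δ : Pt) : Set where
  field
    sign     : ℤ
    isSign   : IsSign sign
    is-along : δ ≡ along d sign

forward : ∀ {d} → Along d (along d (+ 1))
forward = record { sign = + 1 ; isSign = plus ; is-along = refl }

backward : ∀ {d} → Along d (along d -[1+ 0 ])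
backward = record { sign = -[1+ 0 ] ; isSign = minus ; is-along = refl }

flip : Dir → Bool × Bool → Bool × Bool
flip horizontal (a , b) = (not a , b)
flip ascending  (a , b) = (not a , not b)
flip vertical   (a , b) = (a , not b)
flip descending (a , b) = (not a , not b)

flip-involutive : ∀ d q → flip d (flip d q) ≡ q
flip-involutive horizontal (a , b) = cong (_, b) (not-involutive a)
flip-involutive ascending  (a , b) = cong₂ _,_ (not-involutive a) (not-involutive b)
flip-involutive vertical   (a , b) = cong (a ,_) (not-involutive b)
flip-involutive descending (a , b) = cong₂ _,_ (not-involutive a) (not-involutive b)

parities-along : ∀ d {s} → IsSign s → ∀ v → parities (v ⊕ along d s) ≡ flip d (parities v)
parities-along horizontal σ (x , y) = cong₂ _,_ (oddℤ-step σ x) (oddℤ-+0 y)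
parities-along ascending  σ (x , y) = cong₂ _,_ (oddℤ-step σ x) (oddℤ-step σ y)
parities-along vertical   σ (x , y) = cong₂ _,_ (oddℤ-+0 x) (oddℤ-step σ y)
parities-along descending σ (x , y) = cong₂ _,_ (oddℤ-step σ x) (oddℤ-step (negate σ) y)

parities-step : ∀ {d δ} → Along d δ → ∀ v → parities (v ⊕ δ) ≡ flip d (parities v)
parities-step {d} a v rewrite Along.is-along a = parities-along d (Along.isSign a) v

data TypePair : Kind → ℕ → ℕ → Set where
  vertex-edge : TypePair axial 0 1
  edge-vertex : TypePair axial 1 0
  edge-face   : TypePair axial 1 2
  face-edge   : TypePair axial 2 1
  vertex-face : TypePair diagonal 0 2
  face-vertex : TypePair diagonal 2 0

step-types : ∀ d q → weight q ≢ weight (flip d q) →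
  TypePair (kind d) (weight q) (weight (flip d q))
step-types horizontal (false , false) _ = vertex-edge
step-types horizontal (true  , false) _ = edge-vertex
step-types horizontal (false , true)  _ = edge-face
step-types horizontal (true  , true)  _ = face-edge
step-types vertical   (false , false) _ = vertex-edge
step-types vertical   (false , true)  _ = edge-vertex
step-types vertical   (true  , false) _ = edge-face
step-types vertical   (true  , true)  _ = face-edge
step-types ascending  (false , false) _ = vertex-face
step-types ascending  (true  , true)  _ = face-vertex
step-types ascending  (true  , false) distinct = ⊥-elim (distinct refl)
step-types ascending  (false , true)  distinct = ⊥-elim (distinct refl)
step-types descending (false , false) _ = vertex-face
step-types descending (true  , true)  _ = face-vertex
step-types descending (true  , false) distinct = ⊥-elim (distinct refl)
step-types descending (false , true)  distinct = ⊥-elim (distinct refl)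

-- The fixed unit steps of a reflection z ↦ iᵏ z̄ + t

-- direction of the mirrors of z ↦ iᵏ z̄ (the line through 0 at angle kπ/4)
mirrorDir : ℕ → Dir
mirrorDir 0 = horizontal
mirrorDir 1 = ascending
mirrorDir 2 = vertical
mirrorDir 3 = descending
mirrorDir (suc (suc (suc (suc k)))) = mirrorDir k

rot⁴ : ∀ v → rot (rot (rot (rot v))) ≡ v
rot⁴ (x , y) = cong₂ _,_ (ℤP.neg-involutive x) (ℤP.neg-involutive y)

data Small : ℤ → Set where
  nil : Small (+ 0)
  pos : Small (+ 1)
  neg : Small -[1+ 0 ]

small : ∀ {z} → ∣ z ∣ ≤ 1 → Small z
small {+ zero}          _ = nil
small {+ suc zero}      _ = pos
small { -[1+ zero ]}    _ = neg
small {+ suc (suc _)}   (s≤s ())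
small { -[1+ suc _ ]}   (s≤s ())

fixed-unit-step : ∀ k {x y} → Small x → Small y → (x , y) ≢ (+ 0 , + 0) →
  rot^ k (conj (x , y)) ≡ (x , y) → Along (mirrorDir k) (x , y)
fixed-unit-step 0 nil nil nonzero _  = ⊥-elim (nonzero refl)
fixed-unit-step 0 pos nil _ _        = forward
fixed-unit-step 0 neg nil _ _        = backward
fixed-unit-step 0 _   pos _ ()
fixed-unit-step 0 _   neg _ ()
fixed-unit-step 1 nil nil nonzero _  = ⊥-elim (nonzero refl)
fixed-unit-step 1 pos pos _ _        = forward
fixed-unit-step 1 neg neg _ _        = backward
fixed-unit-step 1 nil pos _ ()
fixed-unit-step 1 nil neg _ ()
fixed-unit-step 1 pos nil _ ()
fixed-unit-step 1 pos neg _ ()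
fixed-unit-step 1 neg nil _ ()
fixed-unit-step 1 neg pos _ ()
fixed-unit-step 2 nil nil nonzero _  = ⊥-elim (nonzero refl)
fixed-unit-step 2 nil pos _ _        = forward
fixed-unit-step 2 nil neg _ _        = backward
fixed-unit-step 2 pos _   _ ()
fixed-unit-step 2 neg _   _ ()
fixed-unit-step 3 nil nil nonzero _  = ⊥-elim (nonzero refl)
fixed-unit-step 3 pos neg _ _        = forward
fixed-unit-step 3 neg pos _ _        = backward
fixed-unit-step 3 nil pos _ ()
fixed-unit-step 3 nil neg _ ()
fixed-unit-step 3 pos nil _ ()
fixed-unit-step 3 pos pos _ ()
fixed-unit-step 3 neg nil _ ()
fixed-unit-step 3 neg neg _ ()
fixed-unit-step (suc (suc (suc (suc k)))) sx sy nonzero fixed =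
  fixed-unit-step k sx sy nonzero (trans (sym (rot⁴ _)) fixed)

reflection-direction : ∀ f → Sym.rev f ≡ true →
  ∀ δ → IsStep δ → lin f δ ≡ δ → Along (mirrorDir (Sym.k f)) δ
reflection-direction f reversing (x , y) (∣x∣≤1 , ∣y∣≤1 , nonzero) fixed
  rewrite reversing = fixed-unit-step (Sym.k f) (small ∣x∣≤1) (small ∣y∣≤1) nonzero fixed

-- Mirrors are straight closed walks

⊕-⊖-cancel : ∀ v w → v ⊕ (w ⊖ v) ≡ w
⊕-⊖-cancel (a , b) (c , d) = cong₂ _,_ (cancel a c) (cancel b d)
  where cancel : ∀ a c → a + (c - a) ≡ c
        cancel = solve-∀

⊕-assoc : ∀ u v w → (u ⊕ v) ⊕ w ≡ u ⊕ (v ⊕ w)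
⊕-assoc (a , b) (c , d) (e , f) = cong₂ _,_ (ℤP.+-assoc a c e) (ℤP.+-assoc b d f)

⊕-identityʳ : ∀ v → v ⊕ (+ 0 , + 0) ≡ v
⊕-identityʳ (a , b) = cong₂ _,_ (ℤP.+-identityʳ a) (ℤP.+-identityʳ b)

⊕-⊖-shift : ∀ v u w → (v ⊕ u) ⊖ (v ⊕ w) ≡ u ⊖ w
⊕-⊖-shift (a , b) (c , d) (e , f) = cong₂ _,_ (shift a c e) (shift b d f)
  where shift : ∀ a c e → (a + c) - (a + e) ≡ c - e
        shift = solve-∀

Period : Pt → Dir → ℕ → Set
Period ω d N = ∀ z → InLattice ω (along d z) ⇔ + N ∣ z

module MirrorWalk {ω f n p d N} (M : Mirror ω f n p) (2≤N : 2 ≤ N)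
  (only-d : ∀ δ → IsStep δ → lin f δ ≡ δ → Along d δ) (period : Period ω d N) where

  open Walk N 2≤N

  step : ℕ → Pt
  step i = p (suc i) ⊖ p i

  closes-up-on-torus : ∀ i → p (i ℕ.+ n) ≡[ ω ] p i
  closes-up-on-torus = proj₁ (proj₂ M)

  edge : ∀ i → FixedEdge ω f (p i) (step i)
  edge = proj₁ (proj₂ (proj₂ M))

  injective : ∀ i j → i < n → j < n → p i ≡[ ω ] p j → i ≡ j
  injective = proj₁ (proj₂ (proj₂ (proj₂ M)))

  maximal : ∀ i δ → FixedEdge ω f (p i) δ → ∃ λ j → (p i ⊕ δ) ≡[ ω ] p j
  maximal = proj₂ (proj₂ (proj₂ (proj₂ M)))

  step-is-unit : ∀ i → IsStep (step i)
  step-is-unit i = proj₁ (edge i)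

  types-differ : ∀ i → type (p i) ≢ type (p i ⊕ step i)
  types-differ i = proj₁ (proj₂ (edge i))

  point-fixed : ∀ i → Fixed ω f (p i)
  point-fixed i = proj₁ (proj₂ (proj₂ (edge i)))

  step-fixed : ∀ i → lin f (step i) ≡ step i
  step-fixed i = proj₂ (proj₂ (proj₂ (edge i)))

  along-d : ∀ i → Along d (step i)
  along-d i = only-d (step i) (step-is-unit i) (step-fixed i)

  e : ℕ → ℤ
  e i = Along.sign (along-d i)

  c : ℕ → ℤ
  c = position e

  next : ∀ i → p (suc i) ≡ p i ⊕ step i
  next i = sym (⊕-⊖-cancel (p i) (p (suc i)))

  advance : ∀ a i → (p 0 ⊕ along d a) ⊕ step i ≡ p 0 ⊕ along d (a + e i)
  advance a i = begin
    (p 0 ⊕ along d a) ⊕ step i             ≡⟨ cong ((p 0 ⊕ along d a) ⊕_) (Along.is-along (along-d i)) ⟩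
    (p 0 ⊕ along d a) ⊕ along d (e i)      ≡⟨ ⊕-assoc (p 0) (along d a) (along d (e i)) ⟩
    p 0 ⊕ (along d a ⊕ along d (e i))      ≡⟨ cong (p 0 ⊕_) (along-+ d a (e i)) ⟩
    p 0 ⊕ along d (a + e i)                ∎
    where open ≡-Reasoning

  on-line : ∀ i → p i ≡ p 0 ⊕ along d (c i)
  on-line zero    = sym (trans (cong (p 0 ⊕_) (along-zero d)) (⊕-identityʳ (p 0)))
  on-line (suc i) = trans (next i) (trans (cong (_⊕ step i) (on-line i)) (advance (c i) i))

  line-congruence : ∀ a b → (p 0 ⊕ along d a) ≡[ ω ] (p 0 ⊕ along d b) ⇔ a ≋ b
  line-congruence a b = mk⇔
    (λ same → congruent (to (period (a - b)) (subst (InLattice ω) difference-along same)))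
    (λ a≋b → subst (InLattice ω) (sym difference-along) (from (period (a - b)) (difference a≋b)))
    where
    difference-along : (p 0 ⊕ along d a) ⊖ (p 0 ⊕ along d b) ≡ along d (a - b)
    difference-along = trans (⊕-⊖-shift (p 0) (along d a) (along d b)) (along-- d a b)

  mirror-congruence : ∀ i j → p i ≡[ ω ] p j ⇔ c i ≋ c j
  mirror-congruence i j =
    subst₂ (λ u v → u ≡[ ω ] v ⇔ c i ≋ c j) (sym (on-line i)) (sym (on-line j))
      (line-congruence (c i) (c j))

  type-after : ∀ i v → type (v ⊕ step i) ≡ weight (flip d (parities v))
  type-after i v = trans (type≡weight (v ⊕ step i)) (cong weight (parities-step (along-d i) v))

  -- continuing straight on past p (suc i) is again a fixed edge, so it
  -- leads back onto the mirror
  continue : ∀ i → ∃ λ j → c (suc i) + e i ≋ c j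
  continue i = map₂
    (λ {j} ahead → to (line-congruence (c (suc i) + e i) (c j))
                      (subst₂ _≡[ ω ]_ beyond (on-line j) ahead))
    (maximal (suc i) (step i) straight-on)
    where
    straight-on : FixedEdge ω f (p (suc i)) (step i)
    straight-on = step-is-unit i
      , (λ same → types-differ (suc i)
           (trans same (trans (type-after i (p (suc i))) (sym (type-after (suc i) (p (suc i)))))))
      , point-fixed (suc i)
      , step-fixed i
    beyond : p (suc i) ⊕ step i ≡ p 0 ⊕ along d (c (suc i) + e i)
    beyond = trans (cong (_⊕ step i) (on-line (suc i))) (advance (c (suc i)) i)

  cycle : Cycle e n
  cycle = record
    { unit-steps = λ i → Along.isSign (along-d i)
    ; nonempty   = proj₁ M
    ; closes-up  = λ i → to (mirror-congruence (i ℕ.+ n) i) (closes-up-on-torus i)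
    ; simple     = λ i j i<n j<n ci≋cj → injective i j i<n j<n (from (mirror-congruence i j) ci≋cj)
    ; extendable = continue
    }

  mirror-length : n ≡ N
  mirror-length = cycle-length n cycle

  type-next : ∀ i → type (p (suc i)) ≡ weight (flip d (parities (p i)))
  type-next i = trans (cong type (next i)) (type-after i (p i))

  parities-next : ∀ i → parities (p (suc i)) ≡ flip d (parities (p i))
  parities-next i = trans (cong parities (next i)) (parities-step (along-d i) (p i))

  types-alternate : ∀ i → type (p (2 ℕ.+ i)) ≡ type (p i)
  types-alternate i = begin
    type (p (2 ℕ.+ i))                          ≡⟨ type-next (suc i) ⟩
    weight (flip d (parities (p (suc i))))      ≡⟨ cong (λ q → weight (flip d q)) (parities-next i) ⟩
    weight (flip d (flip d (parities (p i))))   ≡⟨ cong weight (flip-involutive d (parities (p i))) ⟩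
    weight (parities (p i))                     ≡⟨ type≡weight (p i) ⟨
    type (p i)                                  ∎
    where open ≡-Reasoning

  first-types : TypePair (kind d) (type (p 0)) (type (p 1))
  first-types = subst₂ (TypePair (kind d)) (sym (type≡weight (p 0))) (sym (type-next 0))
                  (step-types d (parities (p 0)) distinct)
    where
    distinct : weight (parities (p 0)) ≢ weight (flip d (parities (p 0)))
    distinct same = types-differ 0
      (trans (type≡weight (p 0)) (trans same (sym (type-after 0 (p 0)))))

alternating : ∀ (t : ℕ → ℕ) → (∀ i → t (2 ℕ.+ i) ≡ t i) →
  ∀ r {x y} → t r ≡ x → t (suc r) ≡ y → ∀ i → t (r ℕ.+ i) ≡ alt x y i
alternating t period r tr _ zero rewrite ℕP.+-identityʳ r = tr
alternating t period r _ tr+1 (suc zero) rewrite ℕP.+-comm r 1 = tr+1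
alternating t period r tr tr+1 (suc (suc i)) = begin
  t (r ℕ.+ suc (suc i))  ≡⟨ cong t (trans (ℕP.+-suc r (suc i)) (cong suc (ℕP.+-suc r i))) ⟩
  t (2 ℕ.+ (r ℕ.+ i))    ≡⟨ period (r ℕ.+ i) ⟩
  t (r ℕ.+ i)            ≡⟨ alternating t period r tr tr+1 i ⟩
  alt _ _ i              ∎
  where open ≡-Reasoning

halfPeriod : ℕ → ℕ → Kind → ℕ
halfPeriod Ka Kd axial    = Ka
halfPeriod Ka Kd diagonal = Kd

mirror-pattern : ∀ {n p Ka Kd k x y} → (∀ i → type (p (2 ℕ.+ i)) ≡ type (p i)) →
  TypePair k x y → type (p 0) ≡ x → type (p 1) ≡ y → n ≡ 2 ℕ.* halfPeriod Ka Kd k →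
  HasPattern n p 0 1 Ka ⊎ HasPattern n p 0 2 Kd ⊎ HasPattern n p 1 2 Ka
mirror-pattern {p = p} alt₂ vertex-edge t0 t1 len =
  inj₁ (len , 0 , alternating (λ i → type (p i)) alt₂ 0 t0 t1)
mirror-pattern {p = p} alt₂ edge-vertex t0 t1 len =
  inj₁ (len , 1 , alternating (λ i → type (p i)) alt₂ 1 t1 (trans (alt₂ 0) t0))
mirror-pattern {p = p} alt₂ vertex-face t0 t1 len =
  inj₂ (inj₁ (len , 0 , alternating (λ i → type (p i)) alt₂ 0 t0 t1))
mirror-pattern {p = p} alt₂ face-vertex t0 t1 len =
  inj₂ (inj₁ (len , 1 , alternating (λ i → type (p i)) alt₂ 1 t1 (trans (alt₂ 0) t0)))
mirror-pattern {p = p} alt₂ edge-face t0 t1 len =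
  inj₂ (inj₂ (len , 0 , alternating (λ i → type (p i)) alt₂ 0 t0 t1))
mirror-pattern {p = p} alt₂ face-edge t0 t1 len =
  inj₂ (inj₂ (len , 1 , alternating (λ i → type (p i)) alt₂ 1 t1 (trans (alt₂ 0) t0)))

classify : ∀ ω Ka Kd → 1 ≤ Ka → 1 ≤ Kd →
  (∀ d → Period ω d (2 ℕ.* halfPeriod Ka Kd (kind d))) →
  ∀ f → IsReflection ω f → ∀ n p → Mirror ω f n p →
  HasPattern n p 0 1 Ka ⊎ HasPattern n p 0 2 Kd ⊎ HasPattern n p 1 2 Ka
classify ω Ka Kd 1≤Ka 1≤Kd period f (_ , reversing , _) n p M =
  mirror-pattern {n} {p} types-alternate first-types refl refl mirror-length
  where
  d = mirrorDir (Sym.k f)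
  2≤period : ∀ k → 2 ≤ 2 ℕ.* halfPeriod Ka Kd k
  2≤period axial    = ℕP.*-monoʳ-≤ 2 1≤Ka
  2≤period diagonal = ℕP.*-monoʳ-≤ 2 1≤Kd
  open MirrorWalk {ω} {f} {n} {p} M (2≤period (kind d)) (reflection-direction f reversing) (period d)

-- The lattices of {4,4}_{b,0} and {4,4}_{b,b}

∣0 : ∀ {k} → k ∣ + 0
∣0 = divides (+ 0) refl

module Lattices (b : ℕ) where

  2b 4b : ℤ
  2b = + (2 ℕ.* b)
  4b = + (2 ℕ.* (2 ℕ.* b))

  2b≡ : + 2 * + b ≡ 2b
  2b≡ = sym (ℤP.pos-* 2 b)

  4b≡ : + 2 * (+ 2 * + b) ≡ 4b
  4b≡ = trans (cong (+ 2 *_) 2b≡) (sym (ℤP.pos-* 2 (2 ℕ.* b)))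

  2b∣4b : 2b ∣ 4b
  2b∣4b = divides (+ 2) (ℤP.pos-* 2 (2 ℕ.* b))

  lattice₁ : ∀ x y → InLattice (ω₁ b) (x , y) ⇔ ((2b ∣ x) × (2b ∣ y))
  lattice₁ x y = mk⇔
    (λ { (m , n , eq) → divides m (trans (cong proj₁ eq) (first m n))
                      , divides n (trans (cong proj₂ eq) (second m n)) })
    (λ { (divides m x≡ , divides n y≡) → m , n , cong₂ _,_ (trans x≡ (sym (first m n)))
                                                           (trans y≡ (sym (second m n))) })
    where
    first : ∀ m n → + 2 * (m * + b - n * + 0) ≡ m * 2b
    first m n = trans (ring m n (+ b)) (cong (m *_) 2b≡)
      where ring : ∀ m n B → + 2 * (m * B - n * + 0) ≡ m * (+ 2 * B)
            ring = solve-∀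
    second : ∀ m n → + 2 * (m * + 0 + n * + b) ≡ n * 2b
    second m n = trans (ring m n (+ b)) (cong (n *_) 2b≡)
      where ring : ∀ m n B → + 2 * (m * + 0 + n * B) ≡ n * (+ 2 * B)
            ring = solve-∀

  lattice₂ : ∀ x y → InLattice (ω₂ b) (x , y) ⇔ ((2b ∣ x) × (4b ∣ x + y))
  lattice₂ x y = mk⇔
    (λ { (m , n , eq) → divides (m - n) (trans (cong proj₁ eq) (difference m n))
                      , divides m (trans (cong₂ _+_ (cong proj₁ eq) (cong proj₂ eq)) (sum m n)) })
    (λ { (divides u x≡ , divides v x+y≡) → v , v - u , cong₂ _,_
           (trans x≡ (sym (first u v)))
           (trans (sym (recover x y)) (trans (cong₂ _-_ x+y≡ x≡) (second u v))) })
    where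
    difference : ∀ m n → + 2 * (m * + b - n * + b) ≡ (m - n) * 2b
    difference m n = trans (ring m n (+ b)) (cong ((m - n) *_) 2b≡)
      where ring : ∀ m n B → + 2 * (m * B - n * B) ≡ (m - n) * (+ 2 * B)
            ring = solve-∀
    sum : ∀ m n → + 2 * (m * + b - n * + b) + + 2 * (m * + b + n * + b) ≡ m * 4b
    sum m n = trans (ring m n (+ b)) (cong (m *_) 4b≡)
      where ring : ∀ m n B → + 2 * (m * B - n * B) + + 2 * (m * B + n * B) ≡ m * (+ 2 * (+ 2 * B))
            ring = solve-∀
    first : ∀ u v → + 2 * (v * + b - (v - u) * + b) ≡ u * 2b
    first u v = trans (ring u v (+ b)) (cong (u *_) 2b≡)
      where ring : ∀ u v B → + 2 * (v * B - (v - u) * B) ≡ u * (+ 2 * B)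
            ring = solve-∀
    recover : ∀ x y → (x + y) - x ≡ y
    recover = solve-∀
    second : ∀ u v → v * 4b - u * 2b ≡ + 2 * (v * + b + (v - u) * + b)
    second u v = trans (cong₂ (λ P Q → v * P - u * Q) (sym 4b≡) (sym 2b≡)) (ring u v (+ b))
      where ring : ∀ u v B → v * (+ 2 * (+ 2 * B)) - u * (+ 2 * B) ≡ + 2 * (v * B + (v - u) * B)
            ring = solve-∀

  period₁ : ∀ d → Period (ω₁ b) d (2 ℕ.* halfPeriod b b (kind d))
  period₁ horizontal z = ⇔.trans (lattice₁ z (+ 0)) (mk⇔ proj₁ (_, ∣0))
  period₁ ascending  z = ⇔.trans (lattice₁ z z) (mk⇔ proj₁ (λ h → h , h))
  period₁ vertical   z = ⇔.trans (lattice₁ (+ 0) z) (mk⇔ proj₂ (∣0 ,_))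
  period₁ descending z = ⇔.trans (lattice₁ z (- z)) (mk⇔ proj₁ (λ h → h , ∣m⇒∣-m h))

  period₂ : ∀ d → Period (ω₂ b) d (2 ℕ.* halfPeriod (2 ℕ.* b) b (kind d))
  period₂ horizontal z = ⇔.trans (lattice₂ z (+ 0)) (mk⇔
    (λ h → subst (4b ∣_) (ℤP.+-identityʳ z) (proj₂ h))
    (λ h → ∣-trans 2b∣4b h , subst (4b ∣_) (sym (ℤP.+-identityʳ z)) h))
  period₂ vertical z = ⇔.trans (lattice₂ (+ 0) z) (mk⇔
    (λ h → subst (4b ∣_) (ℤP.+-identityˡ z) (proj₂ h))
    (λ h → ∣0 , subst (4b ∣_) (sym (ℤP.+-identityˡ z)) h))
  period₂ ascending z = ⇔.trans (lattice₂ z z) (mk⇔ proj₁ (λ h → h , doubled h))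
    where
    doubled : 2b ∣ z → 4b ∣ z + z
    doubled (divides q z≡) = divides q (trans (cong₂ _+_ z≡ z≡)
      (trans (cong (λ P → q * P + q * P) (sym 2b≡)) (trans (ring q (+ b)) (cong (q *_) 4b≡))))
      where ring : ∀ q B → q * (+ 2 * B) + q * (+ 2 * B) ≡ q * (+ 2 * (+ 2 * B))
            ring = solve-∀
  period₂ descending z = ⇔.trans (lattice₂ z (- z)) (mk⇔ proj₁
    (λ h → h , subst (4b ∣_) (sym (ℤP.+-inverseʳ z)) ∣0))

theorem4p1 : (b : ℕ) → 1 ≤ b →
    (∀ f → IsReflection (ω₁ b) f → ∀ n p → Mirror (ω₁ b) f n p →
        HasPattern n p 0 1 b ⊎ HasPattern n p 0 2 b ⊎ HasPattern n p 1 2 b)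
    × (∀ f → IsReflection (ω₂ b) f → ∀ n p → Mirror (ω₂ b) f n p →
        HasPattern n p 0 1 (2 ℕ.* b) ⊎ HasPattern n p 0 2 b ⊎ HasPattern n p 1 2 (2 ℕ.* b))
theorem4p1 b 1≤b =
    classify (ω₁ b) b b 1≤b 1≤b period₁
  , classify (ω₂ b) (2 ℕ.* b) b (ℕP.≤-trans 1≤b (ℕP.m≤n*m b 2)) 1≤b period₂
  where open Lattices b
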